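{- Let $\lambda$ be a nonzero real parameter, $m\in\mathbb{N}$ and $r\in\mathbb{N}\cup\{0\}$. For integers $1\le k\le n$, \[ W_{m,r}(n+1,k\mid\lambda)=(r+mk)W_{m,r}(n,k\mid\lambda)+W_{m,r}(n,k-1\mid\lambda)-n\lambda\, W_{m,r}(n,k\mid\lambda). \]
   Context: The degenerate Whitney numbers $W_{m,r}(n,k\mid\lambda)$ ($n,k\ge0$) are defined by \[ \frac{1}{m^k k!}(1+\lambda t)^{r/\lambda}\big((1+\lambda t)^{m/\lambda}-1\big)^k=\sum_{n=k}^\infty W_{m,r}(n,k\mid\lambda)\frac{t^n}{n!}. \]
   Formalization: The parameter λ ranges over the nonzero rationals instead of the nonzero reals. -}

module Defs where

open import Data.Nat as ℕ using (ℕ; zero; suc; NonZero; _!)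
open import Data.Nat.Properties using (m*n≢0; m^n≢0; _!≢0)
open import Data.Nat.Combinatorics using (_C_)
open import Data.Integer using (+_)
open import Data.Rational using (ℚ; 0ℚ; 1ℚ; _+_; _*_; _-_; _/_)

ℕ→ℚ : ℕ → ℚ
ℕ→ℚ n = + n / 1

-- Formal power series (exponential generating functions) over ℚ are
-- represented by their EGF coefficient sequences: F(t) = Σ_n F n t^n / n!.
EGF : Set
EGF = ℕ → ℚ

Σ≤ : ℕ → (ℕ → ℚ) → ℚ
Σ≤ zero    f = f zero
Σ≤ (suc n) f = Σ≤ n f + f (suc n)

_⊛_ : EGF → EGF → EGF
(F ⊛ G) n = Σ≤ n (λ i → ℕ→ℚ (n C i) * (F i * G (n ℕ.∸ i)))

one : EGF
one zero    = 1ℚ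
one (suc _) = 0ℚ

_^⊛_ : EGF → ℕ → EGF
F ^⊛ zero  = one
F ^⊛ suc k = F ⊛ (F ^⊛ k)

dfall : ℚ → ℚ → ℕ → ℚ
dfall lam x zero    = 1ℚ
dfall lam x (suc n) = dfall lam x n * (x - ℕ→ℚ n * lam)

-- (1 + λ t)^{x/λ} = Σ_n (x)_{n,λ} t^n / n!
degExp : ℚ → ℚ → EGF
degExp lam x = dfall lam x

degExpM1 : ℚ → ℚ → EGF
degExpM1 lam x zero    = 0ℚ
degExpM1 lam x (suc n) = degExp lam x (suc n)

W : (m r : ℕ) → .{{NonZero m}} → (n k : ℕ) → (lam : ℚ) → ℚ
W m r n k lam =
  ((degExp lam (ℕ→ℚ r) ⊛ (degExpM1 lam (ℕ→ℚ m) ^⊛ k)) n)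
    * ((+ 1) / (m ℕ.^ k ℕ.* k !))
  where instance
    _ = m^n≢0 m k
    _ = k !≢0
    _ = m*n≢0 (m ℕ.^ k) (k !)

{-# OPTIONS --safe #-}
module Submission where

-- The operator θ = (1 + λt) d/dt is a derivation of the product of exponential generating
-- functions and multiplies (1 + λt)^{x/λ} by x. For B = (1 + λt)^{m/λ} - 1 this gives
-- θ B = m (B + 1), hence θ Bᵏ = mk (Bᵏ + Bᵏ⁻¹), and for A = (1 + λt)^{r/λ}
--   θ (A Bᵏ) = (r + mk) A Bᵏ + mk A Bᵏ⁻¹.
-- On coefficients θ F n = F (n + 1) + λ n F n, so comparing coefficients of tⁿ/n! and
-- dividing by mᵏ k! gives the recurrence.

open import Defs
open import Algebra.Bundles using (CommutativeMonoid)
import Algebra.Properties.CommutativeSemigroup as CommutativeSemigroupProperties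
open import Data.Integer using (+_)
import Data.Integer as ℤ
import Data.Integer.Properties as ℤ
open import Data.Maybe using (map)
open import Data.Nat as ℕ using (ℕ; zero; suc; NonZero; _!; _≤_; _∸_)
open import Data.Nat.Combinatorics using (_C_; nCk+nC[k+1]≡[n+1]C[k+1]; k>n⇒nCk≡0)
open import Data.Nat.Coprimality using (1-coprimeTo)
import Data.Nat.Coprimality as Coprime
import Data.Nat.Properties as ℕ
open import Data.Nat.Properties using (_!≢0)
open import Data.Rational using (ℚ; mkℚ; 0ℚ; 1ℚ; _+_; _*_; _-_; _/_)
open import Data.Rational.Properties
  using ( _≟_; +-*-commutativeRing; +-0-commutativeMonoid; normalize-coprime; /-cong; *-inverseʳ
        ; +-identityʳ; *-identityˡ; *-zeroˡ; *-zeroʳ; +-assoc; *-assoc; *-comm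
        ; *-distribˡ-+; *-distribʳ-+)
open import Function using (const)
open import Level using (0ℓ)
open import Relation.Binary.PropositionalEquality
open import Relation.Nullary.Decidable using (dec⇒maybe)
open import Tactic.RingSolver using (solve-∀)
open import Tactic.RingSolver.Core.AlmostCommutativeRing
  using (AlmostCommutativeRing; fromCommutativeRing)

open CommutativeSemigroupProperties ℕ.*-commutativeSemigroup
  using () renaming (interchange to *-interchange)
open CommutativeSemigroupProperties (CommutativeMonoid.commutativeSemigroup +-0-commutativeMonoid)
  using (x∙yz≈y∙xz) renaming (interchange to +-interchange)
open ≡-Reasoning

ℚ-ring : AlmostCommutativeRing 0ℓ 0ℓ
ℚ-ring = fromCommutativeRing +-*-commutativeRing (λ x → map sym (dec⇒maybe (x ≟ 0ℚ)))

-- ℕ→ℚ n and + 1 / (n + 1) are already in lowest terms; in mkℚ form, _+_ and _*_ on them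
-- compute to a single fraction.
ℕ→ℚ-mkℚ : ∀ n → ℕ→ℚ n ≡ mkℚ (+ n) 0 (Coprime.sym (1-coprimeTo n))
ℕ→ℚ-mkℚ n = normalize-coprime _

ℕ→ℚ-homo-+ : ∀ a b → ℕ→ℚ (a ℕ.+ b) ≡ ℕ→ℚ a + ℕ→ℚ b
ℕ→ℚ-homo-+ a b = begin
  + (a ℕ.+ b) / 1                 ≡⟨ /-cong numerators refl ⟩
  (+ a ℤ.* + 1 ℤ.+ + b ℤ.* + 1) / 1 ≡⟨ cong₂ _+_ (ℕ→ℚ-mkℚ a) (ℕ→ℚ-mkℚ b) ⟨
  ℕ→ℚ a + ℕ→ℚ b                   ∎
  where
  numerators : + (a ℕ.+ b) ≡ + a ℤ.* + 1 ℤ.+ + b ℤ.* + 1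
  numerators = trans (ℤ.pos-+ a b) (sym (cong₂ ℤ._+_ (ℤ.*-identityʳ (+ a)) (ℤ.*-identityʳ (+ b))))

ℕ→ℚ-homo-* : ∀ a b → ℕ→ℚ (a ℕ.* b) ≡ ℕ→ℚ a * ℕ→ℚ b
ℕ→ℚ-homo-* a b = begin
  + (a ℕ.* b) / 1   ≡⟨ /-cong (ℤ.pos-* a b) refl ⟩
  (+ a ℤ.* + b) / 1 ≡⟨ cong₂ _*_ (ℕ→ℚ-mkℚ a) (ℕ→ℚ-mkℚ b) ⟨
  ℕ→ℚ a * ℕ→ℚ b     ∎

+1/≡mkℚ : ∀ n → + 1 / suc n ≡ mkℚ (+ 1) n (1-coprimeTo (suc n))
+1/≡mkℚ n = normalize-coprime _

ℕ→ℚ-*-inverseʳ : ∀ n .{{_ : NonZero n}} → ℕ→ℚ n * (+ 1 / n) ≡ 1ℚ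
ℕ→ℚ-*-inverseʳ (suc n) = trans (cong₂ _*_ (ℕ→ℚ-mkℚ (suc n)) (+1/≡mkℚ n)) (*-inverseʳ p)
  where
  p : ℚ
  p = mkℚ (+ suc n) 0 (Coprime.sym (1-coprimeTo (suc n)))

+1/[m*n]≡+1/m*+1/n : ∀ m n .{{_ : NonZero m}} .{{_ : NonZero n}} →
                     (+ 1 / (m ℕ.* n)) {{ℕ.m*n≢0 m n}} ≡ (+ 1 / m) * (+ 1 / n)
+1/[m*n]≡+1/m*+1/n (suc m) (suc n) = sym (cong₂ _*_ (+1/≡mkℚ m) (+1/≡mkℚ n))

m*+1/[m*n]≡+1/n : ∀ m n .{{_ : NonZero m}} .{{_ : NonZero n}} →
                  ℕ→ℚ m * (+ 1 / (m ℕ.* n)) {{ℕ.m*n≢0 m n}} ≡ + 1 / n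
m*+1/[m*n]≡+1/n m n = begin
  ℕ→ℚ m * (+ 1 / (m ℕ.* n)) {{ℕ.m*n≢0 m n}} ≡⟨ cong (ℕ→ℚ m *_) (+1/[m*n]≡+1/m*+1/n m n) ⟩
  ℕ→ℚ m * ((+ 1 / m) * (+ 1 / n))           ≡⟨ *-assoc (ℕ→ℚ m) _ _ ⟨
  ℕ→ℚ m * (+ 1 / m) * (+ 1 / n)             ≡⟨ cong (_* (+ 1 / n)) (ℕ→ℚ-*-inverseʳ m) ⟩
  1ℚ * (+ 1 / n)                            ≡⟨ *-identityˡ _ ⟩
  + 1 / n                                   ∎

Σ≤-cong : ∀ n {f g : ℕ → ℚ} → (∀ i → i ≤ n → f i ≡ g i) → Σ≤ n f ≡ Σ≤ n g
Σ≤-cong zero    f≗g = f≗g 0 ℕ.z≤n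
Σ≤-cong (suc n) f≗g =
  cong₂ _+_ (Σ≤-cong n (λ i i≤n → f≗g i (ℕ.m≤n⇒m≤1+n i≤n))) (f≗g (suc n) ℕ.≤-refl)

Σ≤-distrib-+ : ∀ n (f g : ℕ → ℚ) → Σ≤ n (λ i → f i + g i) ≡ Σ≤ n f + Σ≤ n g
Σ≤-distrib-+ zero    f g = refl
Σ≤-distrib-+ (suc n) f g = trans (cong (_+ (f (suc n) + g (suc n))) (Σ≤-distrib-+ n f g))
                                 (+-interchange (Σ≤ n f) (Σ≤ n g) (f (suc n)) (g (suc n)))

*-distribˡ-Σ≤ : ∀ n c (f : ℕ → ℚ) → c * Σ≤ n f ≡ Σ≤ n (λ i → c * f i)
*-distribˡ-Σ≤ zero    c f = refl
*-distribˡ-Σ≤ (suc n) c f =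
  trans (*-distribˡ-+ c (Σ≤ n f) (f (suc n))) (cong (_+ c * f (suc n)) (*-distribˡ-Σ≤ n c f))

Σ≤-head : ∀ n (f : ℕ → ℚ) → Σ≤ (suc n) f ≡ f 0 + Σ≤ n (λ i → f (suc i))
Σ≤-head zero    f = refl
Σ≤-head (suc n) f = trans (cong (_+ f (suc (suc n))) (Σ≤-head n f)) (+-assoc (f 0) _ _)

Σ≤-zero : ∀ n (f : ℕ → ℚ) → (∀ i → f i ≡ 0ℚ) → Σ≤ n f ≡ 0ℚ
Σ≤-zero zero    f f≗0 = f≗0 0
Σ≤-zero (suc n) f f≗0 = cong₂ _+_ (Σ≤-zero n f f≗0) (f≗0 (suc n))

infixl 6 _⊕_
infixr 7 _·_

_⊕_ : EGF → EGF → EGF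
(F ⊕ G) n = F n + G n

_·_ : ℚ → EGF → EGF
(c · F) n = c * F n

-- On coefficient sequences, ∂ is d/dt and t∂ is t d/dt.
∂ : EGF → EGF
∂ F n = F (suc n)

t∂ : EGF → EGF
t∂ F n = ℕ→ℚ n * F n

θ : ℚ → EGF → EGF
θ lam F = ∂ F ⊕ lam · t∂ F

⊛-congˡ : ∀ {F F′} G → F ≗ F′ → F ⊛ G ≗ F′ ⊛ G
⊛-congˡ G F≗F′ n = Σ≤-cong n (λ i _ → cong (λ x → ℕ→ℚ (n C i) * (x * G (n ∸ i))) (F≗F′ i))

⊛-congʳ : ∀ F {G G′} → G ≗ G′ → F ⊛ G ≗ F ⊛ G′
⊛-congʳ F G≗G′ n = Σ≤-cong n (λ i _ → cong (λ x → ℕ→ℚ (n C i) * (F i * x)) (G≗G′ (n ∸ i)))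

⊛-distribʳ-⊕ : ∀ F F′ G → (F ⊕ F′) ⊛ G ≗ F ⊛ G ⊕ F′ ⊛ G
⊛-distribʳ-⊕ F F′ G n =
  trans (Σ≤-cong n (λ i _ → distrib (ℕ→ℚ (n C i)) (F i) (F′ i) (G (n ∸ i)))) (Σ≤-distrib-+ n _ _)
  where
  distrib : ∀ c a b g → c * ((a + b) * g) ≡ c * (a * g) + c * (b * g)
  distrib = solve-∀ ℚ-ring

⊛-distribˡ-⊕ : ∀ F G G′ → F ⊛ (G ⊕ G′) ≗ F ⊛ G ⊕ F ⊛ G′
⊛-distribˡ-⊕ F G G′ n =
  trans (Σ≤-cong n (λ i _ → distrib (ℕ→ℚ (n C i)) (F i) (G (n ∸ i)) (G′ (n ∸ i))))
        (Σ≤-distrib-+ n _ _)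
  where
  distrib : ∀ c f a b → c * (f * (a + b)) ≡ c * (f * a) + c * (f * b)
  distrib = solve-∀ ℚ-ring

⊛-scaleˡ : ∀ c F G → (c · F) ⊛ G ≗ c · (F ⊛ G)
⊛-scaleˡ c F G n =
  trans (Σ≤-cong n (λ i _ → reassoc c (ℕ→ℚ (n C i)) (F i) (G (n ∸ i)))) (sym (*-distribˡ-Σ≤ n c _))
  where
  reassoc : ∀ c k f g → k * ((c * f) * g) ≡ c * (k * (f * g))
  reassoc = solve-∀ ℚ-ring

⊛-scaleʳ : ∀ c F G → F ⊛ (c · G) ≗ c · (F ⊛ G)
⊛-scaleʳ c F G n =
  trans (Σ≤-cong n (λ i _ → reassoc c (ℕ→ℚ (n C i)) (F i) (G (n ∸ i)))) (sym (*-distribˡ-Σ≤ n c _))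
  where
  reassoc : ∀ c k f g → k * (f * (c * g)) ≡ c * (k * (f * g))
  reassoc = solve-∀ ℚ-ring

⊛-identityˡ : ∀ F → one ⊛ F ≗ F
⊛-identityˡ F zero    = trans (*-identityˡ _) (*-identityˡ _)
⊛-identityˡ F (suc n) = begin
  (one ⊛ F) (suc n)                   ≡⟨ Σ≤-head n _ ⟩
  head + Σ≤ n tail                    ≡⟨ cong (_+_ head) (Σ≤-zero n tail tail-vanishes) ⟩
  head + 0ℚ                           ≡⟨ +-identityʳ head ⟩
  1ℚ * (1ℚ * F (suc n))               ≡⟨ *-identityˡ _ ⟩
  1ℚ * F (suc n)                      ≡⟨ *-identityˡ _ ⟩
  F (suc n)                           ∎
  where
  head : ℚ
  head = 1ℚ * (1ℚ * F (suc n))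
  tail : ℕ → ℚ
  tail i = ℕ→ℚ (suc n C suc i) * (0ℚ * F (n ∸ i))
  tail-vanishes : ∀ i → tail i ≡ 0ℚ
  tail-vanishes i =
    trans (cong (ℕ→ℚ (suc n C suc i) *_) (*-zeroˡ (F (n ∸ i)))) (*-zeroʳ (ℕ→ℚ (suc n C suc i)))

⊛-zeroʳ : ∀ F {G} → G ≗ const 0ℚ → F ⊛ G ≗ const 0ℚ
⊛-zeroʳ F {G} G≗0 n = Σ≤-zero n _ term-vanishes
  where
  term-vanishes : ∀ i → ℕ→ℚ (n C i) * (F i * G (n ∸ i)) ≡ 0ℚ
  term-vanishes i = trans (cong (λ x → ℕ→ℚ (n C i) * (F i * x)) (G≗0 (n ∸ i)))
                          (trans (cong (ℕ→ℚ (n C i) *_) (*-zeroʳ (F i))) (*-zeroʳ (ℕ→ℚ (n C i))))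

⊛-∂ʳ : ∀ F G n →
       (F ⊛ ∂ G) n ≡ 1ℚ * (F 0 * G (suc n)) + Σ≤ n (λ i → ℕ→ℚ (n C suc i) * (F (suc i) * G (n ∸ i)))
⊛-∂ʳ F G zero    = sym (trans (cong (_+_ (1ℚ * (F 0 * G 1))) (*-zeroˡ (F 1 * G 0))) (+-identityʳ _))
⊛-∂ʳ F G (suc n) = begin
  (F ⊛ ∂ G) (suc n)                                     ≡⟨ Σ≤-head n _ ⟩
  head + Σ≤ n (λ i → c i * (F (suc i) * G (suc (n ∸ i)))) ≡⟨ cong (_+_ head) (Σ≤-cong n reindex) ⟩
  head + Σ≤ n term                                      ≡⟨ cong (_+_ head) (+-identityʳ _) ⟨
  head + (Σ≤ n term + 0ℚ)
    ≡⟨ cong (λ x → head + (Σ≤ n term + x)) last-vanishes ⟨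
  head + Σ≤ (suc n) term                                ∎
  where
  head : ℚ
  head = 1ℚ * (F 0 * G (suc (suc n)))
  c : ℕ → ℚ
  c i = ℕ→ℚ (suc n C suc i)
  term : ℕ → ℚ
  term i = c i * (F (suc i) * G (suc n ∸ i))
  reindex : ∀ i → i ≤ n → c i * (F (suc i) * G (suc (n ∸ i))) ≡ term i
  reindex i i≤n = cong (λ k → c i * (F (suc i) * G k)) (sym (ℕ.+-∸-assoc 1 i≤n))
  last-vanishes : term (suc n) ≡ 0ℚ
  last-vanishes = trans (cong (λ k → ℕ→ℚ k * last) (k>n⇒nCk≡0 (ℕ.n<1+n (suc n)))) (*-zeroˡ last)
    where
    last : ℚ
    last = F (suc (suc n)) * G (n ∸ n)

∂-⊛ : ∀ F G → ∂ (F ⊛ G) ≗ ∂ F ⊛ G ⊕ F ⊛ ∂ G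
∂-⊛ F G n = begin
  (F ⊛ G) (suc n)
    ≡⟨ Σ≤-head n (λ i → ℕ→ℚ (suc n C i) * (F i * G (suc n ∸ i))) ⟩
  head + Σ≤ n (λ i → ℕ→ℚ (suc n C suc i) * term i)
    ≡⟨ cong (_+_ head) (Σ≤-cong n λ i _ → pascal i) ⟩
  head + Σ≤ n (λ i → ℕ→ℚ (n C i) * term i + ℕ→ℚ (n C suc i) * term i)
    ≡⟨ cong (_+_ head) (Σ≤-distrib-+ n _ _) ⟩
  head + ((∂ F ⊛ G) n + rest)
    ≡⟨ x∙yz≈y∙xz head ((∂ F ⊛ G) n) rest ⟩
  (∂ F ⊛ G) n + (head + rest)
    ≡⟨ cong (_+_ ((∂ F ⊛ G) n)) (⊛-∂ʳ F G n) ⟨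
  (∂ F ⊛ G) n + (F ⊛ ∂ G) n
    ∎
  where
  term : ℕ → ℚ
  term i = F (suc i) * G (n ∸ i)
  head rest : ℚ
  head = 1ℚ * (F 0 * G (suc n))
  rest = Σ≤ n (λ i → ℕ→ℚ (n C suc i) * term i)
  pascal : ∀ i → ℕ→ℚ (suc n C suc i) * term i ≡ ℕ→ℚ (n C i) * term i + ℕ→ℚ (n C suc i) * term i
  pascal i = begin
    ℕ→ℚ (suc n C suc i) * term i
      ≡⟨ cong (λ k → ℕ→ℚ k * term i) (nCk+nC[k+1]≡[n+1]C[k+1] n i) ⟨
    ℕ→ℚ (n C i ℕ.+ n C suc i) * term i
      ≡⟨ cong (_* term i) (ℕ→ℚ-homo-+ (n C i) (n C suc i)) ⟩
    (ℕ→ℚ (n C i) + ℕ→ℚ (n C suc i)) * term i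
      ≡⟨ *-distribʳ-+ (term i) (ℕ→ℚ (n C i)) (ℕ→ℚ (n C suc i)) ⟩
    ℕ→ℚ (n C i) * term i + ℕ→ℚ (n C suc i) * term i
      ∎

t∂-⊛ : ∀ F G → t∂ (F ⊛ G) ≗ t∂ F ⊛ G ⊕ F ⊛ t∂ G
t∂-⊛ F G n = trans (*-distribˡ-Σ≤ n (ℕ→ℚ n) _) (trans (Σ≤-cong n split) (Σ≤-distrib-+ n _ _))
  where
  euler : ∀ a b c f g → (a + b) * (c * (f * g)) ≡ c * ((a * f) * g) + c * (f * (b * g))
  euler = solve-∀ ℚ-ring
  split : ∀ i → i ≤ n → ℕ→ℚ n * (ℕ→ℚ (n C i) * (F i * G (n ∸ i)))
                      ≡ ℕ→ℚ (n C i) * (t∂ F i * G (n ∸ i)) + ℕ→ℚ (n C i) * (F i * t∂ G (n ∸ i))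
  split i i≤n = trans (cong (_* (ℕ→ℚ (n C i) * (F i * G (n ∸ i)))) n≡i+[n∸i])
                      (euler (ℕ→ℚ i) (ℕ→ℚ (n ∸ i)) (ℕ→ℚ (n C i)) (F i) (G (n ∸ i)))
    where
    n≡i+[n∸i] : ℕ→ℚ n ≡ ℕ→ℚ i + ℕ→ℚ (n ∸ i)
    n≡i+[n∸i] = trans (cong ℕ→ℚ (sym (ℕ.m+[n∸m]≡n i≤n))) (ℕ→ℚ-homo-+ i (n ∸ i))

θ-⊛ : ∀ lam F G → θ lam (F ⊛ G) ≗ θ lam F ⊛ G ⊕ F ⊛ θ lam G
θ-⊛ lam F G n = begin
  (F ⊛ G) (suc n) + lam * (ℕ→ℚ n * (F ⊛ G) n)
    ≡⟨ cong₂ (λ x y → x + lam * y) (∂-⊛ F G n) (t∂-⊛ F G n) ⟩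
  (a + b) + lam * (c + d)                       ≡⟨ regroup a b c d lam ⟩
  (a + lam * c) + (b + lam * d)                 ≡⟨ cong₂ _+_ θ-left θ-right ⟨
  (θ lam F ⊛ G) n + (F ⊛ θ lam G) n             ∎
  where
  a b c d : ℚ
  a = (∂ F ⊛ G) n
  b = (F ⊛ ∂ G) n
  c = (t∂ F ⊛ G) n
  d = (F ⊛ t∂ G) n
  regroup : ∀ a b c d l → (a + b) + l * (c + d) ≡ (a + l * c) + (b + l * d)
  regroup = solve-∀ ℚ-ring
  θ-left : (θ lam F ⊛ G) n ≡ a + lam * c
  θ-left = trans (⊛-distribʳ-⊕ (∂ F) (lam · t∂ F) G n) (cong (_+_ a) (⊛-scaleˡ lam (t∂ F) G n))
  θ-right : (F ⊛ θ lam G) n ≡ b + lam * d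
  θ-right = trans (⊛-distribˡ-⊕ F (∂ G) (lam · t∂ G) n) (cong (_+_ b) (⊛-scaleʳ lam F (t∂ G) n))

θ-degExp : ∀ lam x → θ lam (degExp lam x) ≗ x · degExp lam x
θ-degExp lam x n = falling (dfall lam x n) x (ℕ→ℚ n) lam
  where
  falling : ∀ d x k l → d * (x - k * l) + l * (k * d) ≡ x * d
  falling = solve-∀ ℚ-ring

θ-degExpM1 : ∀ lam x → θ lam (degExpM1 lam x) ≗ x · (degExpM1 lam x ⊕ one)
θ-degExpM1 lam x zero    = at-zero x lam
  where
  at-zero : ∀ x l → 1ℚ * (x - 0ℚ * l) + l * (0ℚ * 0ℚ) ≡ x * (0ℚ + 1ℚ)
  at-zero = solve-∀ ℚ-ring
θ-degExpM1 lam x (suc n) = trans (θ-degExp lam x (suc n)) (cong (x *_) (sym (+-identityʳ _)))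

θ-one : ∀ lam → θ lam one ≗ const 0ℚ
θ-one lam zero    = at-zero lam
  where
  at-zero : ∀ l → 0ℚ + l * (0ℚ * 1ℚ) ≡ 0ℚ
  at-zero = solve-∀ ℚ-ring
θ-one lam (suc n) = at-suc lam (ℕ→ℚ (suc n))
  where
  at-suc : ∀ l k → 0ℚ + l * (k * 0ℚ) ≡ 0ℚ
  at-suc = solve-∀ ℚ-ring

module _ (lam c : ℚ) (F : EGF) (θF≗c[F+1] : θ lam F ≗ c · (F ⊕ one)) where

  θF-⊛ : ∀ G → θ lam F ⊛ G ≗ c · (F ⊛ G ⊕ G)
  θF-⊛ G n = begin
    (θ lam F ⊛ G) n          ≡⟨ ⊛-congˡ G θF≗c[F+1] n ⟩
    ((c · (F ⊕ one)) ⊛ G) n  ≡⟨ ⊛-scaleˡ c (F ⊕ one) G n ⟩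
    c * ((F ⊕ one) ⊛ G) n    ≡⟨ cong (c *_) (⊛-distribʳ-⊕ F one G n) ⟩
    c * ((F ⊛ G) n + (one ⊛ G) n) ≡⟨ cong (λ x → c * ((F ⊛ G) n + x)) (⊛-identityˡ G n) ⟩
    c * ((F ⊛ G) n + G n)    ∎

  θ-^⊛ : ∀ j → θ lam (F ^⊛ suc j) ≗ (ℕ→ℚ (suc j) * c) · (F ^⊛ suc j ⊕ F ^⊛ j)
  θ-^⊛ zero n = begin
    θ lam (F ⊛ one) n                      ≡⟨ θ-⊛ lam F one n ⟩
    (θ lam F ⊛ one) n + (F ⊛ θ lam one) n  ≡⟨ cong₂ _+_ (θF-⊛ one n) (⊛-zeroʳ F (θ-one lam) n) ⟩
    c * X + 0ℚ                             ≡⟨ +-identityʳ (c * X) ⟩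
    c * X                                  ≡⟨ cong (_* X) (*-identityˡ c) ⟨
    1ℚ * c * X                             ∎
    where
    X : ℚ
    X = (F ⊛ one) n + one n
  θ-^⊛ (suc j) n = begin
    θ lam (F ⊛ Fᵏ) n                    ≡⟨ θ-⊛ lam F Fᵏ n ⟩
    (θ lam F ⊛ Fᵏ) n + (F ⊛ θ lam Fᵏ) n ≡⟨ cong₂ _+_ (θF-⊛ Fᵏ n) θ-right ⟩
    c * X + k * c * X                   ≡⟨ collect c k X ⟩
    (1ℚ + k) * c * X                    ≡⟨ cong (λ z → z * c * X) (ℕ→ℚ-homo-+ 1 (suc j)) ⟨
    ℕ→ℚ (suc (suc j)) * c * X           ∎
    where
    Fᵏ : EGF
    Fᵏ = F ^⊛ suc j
    k X : ℚ
    k = ℕ→ℚ (suc j)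
    X = (F ⊛ Fᵏ) n + Fᵏ n
    collect : ∀ c k x → c * x + k * c * x ≡ (1ℚ + k) * c * x
    collect = solve-∀ ℚ-ring
    θ-right : (F ⊛ θ lam Fᵏ) n ≡ k * c * X
    θ-right = begin
      (F ⊛ θ lam Fᵏ) n                        ≡⟨ ⊛-congʳ F (θ-^⊛ j) n ⟩
      (F ⊛ ((k * c) · (Fᵏ ⊕ F ^⊛ j))) n        ≡⟨ ⊛-scaleʳ (k * c) F (Fᵏ ⊕ F ^⊛ j) n ⟩
      k * c * (F ⊛ (Fᵏ ⊕ F ^⊛ j)) n            ≡⟨ cong (k * c *_) (⊛-distribˡ-⊕ F Fᵏ (F ^⊛ j) n) ⟩
      k * c * X                               ∎

whitneyEGF : (lam R M : ℚ) → ℕ → EGF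
whitneyEGF lam R M k = degExp lam R ⊛ (degExpM1 lam M ^⊛ k)

θ-whitneyEGF : ∀ lam R M j → let c = ℕ→ℚ (suc j) * M in
               θ lam (whitneyEGF lam R M (suc j))
                 ≗ (R + c) · whitneyEGF lam R M (suc j) ⊕ c · whitneyEGF lam R M j
θ-whitneyEGF lam R M j n = begin
  θ lam (A ⊛ Bᵏ) n                    ≡⟨ θ-⊛ lam A Bᵏ n ⟩
  (θ lam A ⊛ Bᵏ) n + (A ⊛ θ lam Bᵏ) n ≡⟨ cong₂ _+_ θ-left θ-right ⟩
  R * Φᵏ + c * (Φᵏ + Φʲ)              ≡⟨ collect R c Φᵏ Φʲ ⟩
  (R + c) * Φᵏ + c * Φʲ               ∎
  where
  A B Bᵏ : EGF
  A = degExp lam R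
  B = degExpM1 lam M
  Bᵏ = B ^⊛ suc j
  c Φᵏ Φʲ : ℚ
  c = ℕ→ℚ (suc j) * M
  Φᵏ = whitneyEGF lam R M (suc j) n
  Φʲ = whitneyEGF lam R M j n
  collect : ∀ r c x y → r * x + c * (x + y) ≡ (r + c) * x + c * y
  collect = solve-∀ ℚ-ring
  θ-left : (θ lam A ⊛ Bᵏ) n ≡ R * Φᵏ
  θ-left = trans (⊛-congˡ Bᵏ (θ-degExp lam R) n) (⊛-scaleˡ R A Bᵏ n)
  θ-right : (A ⊛ θ lam Bᵏ) n ≡ c * (Φᵏ + Φʲ)
  θ-right = begin
    (A ⊛ θ lam Bᵏ) n               ≡⟨ ⊛-congʳ A (θ-^⊛ lam M B (θ-degExpM1 lam M) j) n ⟩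
    (A ⊛ (c · (Bᵏ ⊕ B ^⊛ j))) n    ≡⟨ ⊛-scaleʳ c A (Bᵏ ⊕ B ^⊛ j) n ⟩
    c * (A ⊛ (Bᵏ ⊕ B ^⊛ j)) n      ≡⟨ cong (c *_) (⊛-distribˡ-⊕ A Bᵏ (B ^⊛ j) n) ⟩
    c * (Φᵏ + Φʲ)                  ∎

normaliser : (m k : ℕ) → .{{NonZero m}} → ℚ
normaliser m k = + 1 / (m ℕ.^ k ℕ.* k !)
  where instance
    _ = ℕ.m^n≢0 m k
    _ = k !≢0
    _ = ℕ.m*n≢0 (m ℕ.^ k) (k !)

normaliser-suc : ∀ m j .{{_ : NonZero m}} →
                 ℕ→ℚ (suc j) * ℕ→ℚ m * normaliser m (suc j) ≡ normaliser m j
normaliser-suc m j = begin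
  ℕ→ℚ (suc j) * ℕ→ℚ m * normaliser m (suc j)
    ≡⟨ cong₂ _*_ numerator (/-cong {p₁ = + 1} refl denominator) ⟩
  ℕ→ℚ (m ℕ.* suc j) * (+ 1 / ((m ℕ.* suc j) ℕ.* (m ℕ.^ j ℕ.* j !)))
    ≡⟨ m*+1/[m*n]≡+1/n (m ℕ.* suc j) (m ℕ.^ j ℕ.* j !) ⟩
  normaliser m j
    ∎
  where
  instance
    _ = ℕ.m^n≢0 m j
    _ = j !≢0
    _ = ℕ.m*n≢0 (m ℕ.^ j) (j !)
    _ = ℕ.m*n≢0 m (suc j)
    _ = ℕ.m*n≢0 (m ℕ.* suc j) (m ℕ.^ j ℕ.* j !)
    _ = ℕ.m*n≢0 (m ℕ.^ suc j) (suc j !) {{ℕ.m^n≢0 m (suc j)}} {{suc j !≢0}}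
  numerator : ℕ→ℚ (suc j) * ℕ→ℚ m ≡ ℕ→ℚ (m ℕ.* suc j)
  numerator = trans (*-comm (ℕ→ℚ (suc j)) (ℕ→ℚ m)) (sym (ℕ→ℚ-homo-* m (suc j)))
  denominator : m ℕ.^ suc j ℕ.* suc j ! ≡ (m ℕ.* suc j) ℕ.* (m ℕ.^ j ℕ.* j !)
  denominator = *-interchange m (m ℕ.^ j) (suc j) (j !)

theorem8 : (lam : ℚ) → lam ≢ 0ℚ → (m r : ℕ) → .{{_ : NonZero m}} →
    (n k : ℕ) → 1 ≤ k → k ≤ n →
      W m r (suc n) k lam
        ≡ (ℕ→ℚ r + ℕ→ℚ m * ℕ→ℚ k) * W m r n k lam
          + W m r n (k ∸ 1) lam
          - ℕ→ℚ n * lam * W m r n k lam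
theorem8 lam _ m r n (suc j) _ _ = begin
  W m r (suc n) (suc j) lam
    ≡⟨⟩
  Φᵏ (suc n) * s
    ≡⟨ cong (_* s) (x≡x+y-y (Φᵏ (suc n)) y) ⟩
  (Φᵏ (suc n) + y - y) * s
    ≡⟨ cong (λ x → (x - y) * s) (θ-whitneyEGF lam R M j n) ⟩
  ((R + K * M) * Φᵏ n + K * M * Φʲ n - y) * s
    ≡⟨ rearrange R M K N lam (Φᵏ n) (Φʲ n) s ⟩
  (R + M * K) * (Φᵏ n * s) + Φʲ n * (K * M * s) - N * lam * (Φᵏ n * s)
    ≡⟨ cong (λ x → (R + M * K) * (Φᵏ n * s) + Φʲ n * x - N * lam * (Φᵏ n * s)) (normaliser-suc m j) ⟩
  (R + M * K) * W m r n (suc j) lam + W m r n j lam - N * lam * W m r n (suc j) lam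
    ∎
  where
  R M K N s : ℚ
  R = ℕ→ℚ r
  M = ℕ→ℚ m
  K = ℕ→ℚ (suc j)
  N = ℕ→ℚ n
  s = normaliser m (suc j)
  Φᵏ Φʲ : EGF
  Φᵏ = whitneyEGF lam R M (suc j)
  Φʲ = whitneyEGF lam R M j
  y : ℚ
  y = lam * (N * Φᵏ n)
  x≡x+y-y : ∀ x y → x ≡ x + y - y
  x≡x+y-y = solve-∀ ℚ-ring
  rearrange : ∀ R M K N l a b s → ((R + K * M) * a + K * M * b - l * (N * a)) * s
                                  ≡ (R + M * K) * (a * s) + b * (K * M * s) - N * l * (a * s)
  rearrange = solve-∀ ℚ-ring
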